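{- Let $\gamma_\sigma$ be the growing-causality event structure $(\{a,b\},\emptyset,\emptyset,\{b\lhd[a\to a]\})$. There is no shrinking-causality event structure (SES) $\sigma$ with $\mathrm{traces}(\sigma)=\mathrm{traces}(\gamma_\sigma)$.
   Context: A growing-causality event structure (GES) is a tuple $\gamma=(E,\#,\to,\lhd)$ with $\#\subseteq E\times E$ irreflexive and symmetric, $\to\ \subseteq E\times E$, and $\lhd\subseteq E^3$; write $m\lhd[c\to t]$ when the occurrence of $m$ adds $c$ as a cause of $t$ (required to imply $\neg(c\to t)$). Let $ic(e)=\{e'\mid e'\to e\}$ and $ac(H,e)=\{e'\mid\exists a\in H.\ a\lhd[e'\to e]\}$. A trace of $\gamma$ is a finite sequence $e_1\cdots e_n$ of pairwise distinct events with $\neg(e_i\#e_j)$ for all $i,j$ and $ic(e_i)\cup ac(\{e_1,\dots,e_{i-1}\},e_i)\subseteq\{e_1,\dots,e_{i-1}\}$ for all $i$. An SES is a tuple $\sigma=(E,\#,\to,\triangleright)$ with $\#\subseteq E\times E$ irreflexive and symmetric, $\to\ \subseteq E\times E$, and $\triangleright\subseteq E^3$; write $[c\to t]\triangleright d$ when the occurrence of $d$ drops the cause $c$ of $t$ (required to imply $c\to t$). With $dc(H,e)=\{e'\mid\exists d\in H.\ [e'\to e]\triangleright d\}$, a trace of $\sigma$ is a finite sequence $e_1\cdots e_n$ of pairwise distinct events with $\neg(e_i\#e_j)$ for all $i,j$ and $ic(e_i)\setminus dc(\{e_1,\dots,e_{i-1}\},e_i)\subseteq\{e_1,\dots,e_{i-1}\}$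 for all $i$. -}

module Defs where

open import Data.Empty using (⊥)
open import Data.Product using (Σ; _×_; ∃)
open import Data.Sum using (_⊎_)
open import Data.List using (List; []; _∷_; _++_; map)
open import Data.List.Membership.Propositional using (_∈_)
open import Data.List.Relation.Unary.Unique.Propositional using (Unique)
open import Relation.Nullary using (¬_)
open import Relation.Binary.PropositionalEquality using (_≡_)
open import Function.Bundles using (_⇔_)

record GES (E : Set) : Set₁ where
  field
    _#_   : E → E → Set
    _⇒_   : E → E → Set                 -- c ⇒ t : c is an initial cause of t
    Add   : E → E → E → Set             -- Add m c t : m ◁ [c → t]
    #-irrefl : ∀ {e} → ¬ (e # e)
    #-sym    : ∀ {e e'} → e # e' → e' # e
    Add-new  : ∀ {m c t} → Add m c t → ¬ (c ⇒ t)

record SES (E : Set) : Set₁ where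
  field
    _#_   : E → E → Set
    _⇒_   : E → E → Set
    Drop  : E → E → E → Set             -- Drop c t d : [c → t] ▷ d
    #-irrefl : ∀ {e} → ¬ (e # e)
    #-sym    : ∀ {e e'} → e # e' → e' # e
    Drop-old : ∀ {c t d} → Drop c t d → c ⇒ t

GESTrace : {E : Set} → GES E → List E → Set
GESTrace {E} γ l =
  Unique l ×
  (∀ {x y} → x ∈ l → y ∈ l → ¬ (x # y)) ×
  (∀ (H : List E) (e : E) (rest : List E) → l ≡ H ++ (e ∷ rest) →
     ∀ e' → (e' ⇒ e ⊎ Σ E (λ m → m ∈ H × Add m e' e)) → e' ∈ H)
  where open GES γ

SESTrace : {E : Set} → SES E → List E → Set
SESTrace {E} σ l =
  Unique l ×
  (∀ {x y} → x ∈ l → y ∈ l → ¬ (x # y)) ×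
  (∀ (H : List E) (e : E) (rest : List E) → l ≡ H ++ (e ∷ rest) →
     ∀ e' → e' ⇒ e → ¬ (Σ E (λ d → d ∈ H × Drop e' e d)) → e' ∈ H)
  where open SES σ

data Ev : Set where
  a b : Ev

γσ : GES Ev
γσ = record
  { _#_ = λ _ _ → ⊥
  ; _⇒_ = λ _ _ → ⊥
  ; Add = λ m c t → m ≡ b × c ≡ a × t ≡ a
  ; #-irrefl = λ ()
  ; #-sym = λ ()
  ; Add-new = λ _ ()
  }

-- traces(σ) = traces(γσ), where the events a, b of γσ are named in σ's event
-- type E via ι : Ev → E (σ may have further events).
SameTraces : {E : Set} → SES E → (Ev → E) → Set
SameTraces {E} σ ι =
  ∀ (l : List E) → SESTrace σ l ⇔ (Σ (List Ev) λ t → GESTrace γσ t × map ι t ≡ l)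

module Submission where

-- The traces of γσ are [], [a], [b] and [a,b]; the sequence [b,a]
-- is not a trace, because b adds a as a cause of a.  Suppose an SES σ (with
-- events a, b named by ι) had exactly the ι-images of these traces.
--   * Since [ι a] and [ι b] are σ-traces with empty history, and an empty
--     history cannot drop a cause, neither ι a nor ι b has an initial cause.
--   * Since [ι a, ι b] is a σ-trace, ι a ≢ ι b and {ι a, ι b} is conflict-free.
--   * In any SES, a duplicate-free, conflict-free sequence of uncaused events
--     is a trace; hence [ι b, ι a] is a σ-trace.
-- As ι is injective, [ι b, ι a] can only be the image of [b, a], which is not a
-- trace of γσ — a contradiction.  Shrinking causality can only remove causes
-- that are present from the start, so it cannot forbid an order that the
-- singleton traces already allow.

open import Defs
open import Relation.Nullary using (¬_)
open import Data.Empty using (⊥-elim)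
open import Data.Product using (Σ; _×_; _,_; proj₁; proj₂)
open import Data.Sum using (_⊎_; inj₁; inj₂)
open import Data.List using (List; []; _∷_; _++_; map)
open import Data.List.Membership.Propositional using (_∈_; _∉_)
open import Data.List.Membership.Propositional.Properties using (∈-++⁺ʳ)
open import Data.List.Properties using (map-injective)
open import Data.List.Relation.Binary.Subset.Propositional using (_⊆_)
open import Data.List.Relation.Unary.Any using (here; there)
open import Data.List.Relation.Unary.All using ([]; _∷_)
open import Data.List.Relation.Unary.AllPairs using ([]; _∷_)
open import Data.List.Relation.Unary.Unique.Propositional using (Unique)
open import Relation.Binary.PropositionalEquality using (_≡_; _≢_; refl; sym; subst; ≢-sym)
open import Function.Bundles using (Equivalence)
open import Function.Definitions using (Injective)

module _ {E : Set} (σ : SES E) where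
  open SES σ

  Uncaused : E → Set
  Uncaused e = ∀ e' → ¬ (e' ⇒ e)

  ConflictFree : List E → Set
  ConflictFree l = ∀ {x y} → x ∈ l → y ∈ l → ¬ (x # y)

  conflictFree-⊆ : ∀ {l l'} → l' ⊆ l → ConflictFree l → ConflictFree l'
  conflictFree-⊆ l'⊆l cf x∈l' y∈l' = cf (l'⊆l x∈l') (l'⊆l y∈l')

  -- An event that can occur first is uncaused: with an empty history no
  -- cause can have been dropped, and none can have occurred.
  singleton-uncaused : ∀ {e} → SESTrace σ (e ∷ []) → Uncaused e
  singleton-uncaused (_ , _ , causal) e' e'⇒e with causal [] _ [] refl e' e'⇒e (λ { (_ , () , _) })
  ... | ()

  uncaused-trace : ∀ {l} → Unique l → ConflictFree l → (∀ {e} → e ∈ l → Uncaused e) →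
                   SESTrace σ l
  uncaused-trace {l} unique cf uncaused = unique , cf , causal
    where
    causal : ∀ H e rest → l ≡ H ++ (e ∷ rest) →
             ∀ e' → e' ⇒ e → ¬ (Σ E λ d → d ∈ H × Drop e' e d) → e' ∈ H
    causal H e rest refl e' e'⇒e _ = ⊥-elim (uncaused (∈-++⁺ʳ H (here refl)) e' e'⇒e)

-- A duplicate-free sequence is a trace of γσ as soon as b never precedes a:
-- the only causality in γσ is the cause a of a, added by b.
γσ-trace : ∀ {t} → Unique t → (∀ H rest → t ≡ H ++ (a ∷ rest) → b ∉ H) → GESTrace γσ t
γσ-trace {t} unique no-b-before-a = unique , (λ _ _ ()) , causal
  where
  open GES γσ
  causal : ∀ H e rest → t ≡ H ++ (e ∷ rest) →
           ∀ e' → (e' ⇒ e ⊎ Σ Ev λ m → m ∈ H × Add m e' e) → e' ∈ H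
  causal H e rest eq e' (inj₁ ())
  causal H a rest eq a (inj₂ (b , b∈H , refl , refl , refl)) =
    ⊥-elim (no-b-before-a H rest eq b∈H)

trace-a : GESTrace γσ (a ∷ [])
trace-a = γσ-trace ([] ∷ []) no-b-before-a
  where
  no-b-before-a : ∀ H rest → a ∷ [] ≡ H ++ (a ∷ rest) → b ∉ H
  no-b-before-a [] _ refl ()
  no-b-before-a (_ ∷ []) _ ()
  no-b-before-a (_ ∷ _ ∷ _) _ ()

trace-b : GESTrace γσ (b ∷ [])
trace-b = γσ-trace ([] ∷ []) no-b-before-a
  where
  no-b-before-a : ∀ H rest → b ∷ [] ≡ H ++ (a ∷ rest) → b ∉ H
  no-b-before-a [] _ ()
  no-b-before-a (_ ∷ []) _ ()
  no-b-before-a (_ ∷ _ ∷ _) _ ()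

trace-ab : GESTrace γσ (a ∷ b ∷ [])
trace-ab = γσ-trace (((λ ()) ∷ []) ∷ [] ∷ []) no-b-before-a
  where
  no-b-before-a : ∀ H rest → a ∷ b ∷ [] ≡ H ++ (a ∷ rest) → b ∉ H
  no-b-before-a [] _ refl ()
  no-b-before-a (_ ∷ []) _ ()
  no-b-before-a (_ ∷ _ ∷ []) _ ()
  no-b-before-a (_ ∷ _ ∷ _ ∷ _) _ ()

-- [b, a] is not a trace of γσ: after b, the event a needs itself as a cause.
not-trace-ba : ¬ GESTrace γσ (b ∷ a ∷ [])
not-trace-ba (_ , _ , causal) with causal (b ∷ []) a [] refl a (inj₂ (b , here refl , refl , refl , refl))
... | here ()
... | there ()

separating-injective : ∀ {E : Set} {ι : Ev → E} → ι a ≢ ι b → Injective _≡_ _≡_ ι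
separating-injective _     {a} {a} _  = refl
separating-injective ιa≢ιb {a} {b} eq = ⊥-elim (ιa≢ιb eq)
separating-injective ιa≢ιb {b} {a} eq = ⊥-elim (ιa≢ιb (sym eq))
separating-injective _     {b} {b} _  = refl

lemma13 : ∀ (E : Set) (σ : SES E) (ι : Ev → E) → ¬ SameTraces σ ι
lemma13 E σ ι same = no-preimage-of-ba (to (same (ι b ∷ ι a ∷ [])) σ-ba)
  where
  open Equivalence

  fromγ : ∀ {t} → GESTrace γσ t → SESTrace σ (map ι t)
  fromγ {t} γσ-t = from (same (map ι t)) (t , γσ-t , refl)

  σ-ab : SESTrace σ (ι a ∷ ι b ∷ [])
  σ-ab = fromγ trace-ab

  ιa≢ιb : ι a ≢ ι b
  ιa≢ιb with proj₁ σ-ab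
  ... | (ιa≢ιb ∷ []) ∷ _ = ιa≢ιb

  swap⊆ : ι b ∷ ι a ∷ [] ⊆ ι a ∷ ι b ∷ []
  swap⊆ (here refl)         = there (here refl)
  swap⊆ (there (here refl)) = here refl

  uncaused-ba : ∀ {e} → e ∈ ι b ∷ ι a ∷ [] → Uncaused σ e
  uncaused-ba (here refl)         = singleton-uncaused σ (fromγ trace-b)
  uncaused-ba (there (here refl)) = singleton-uncaused σ (fromγ trace-a)

  σ-ba : SESTrace σ (ι b ∷ ι a ∷ [])
  σ-ba = uncaused-trace σ ((≢-sym ιa≢ιb ∷ []) ∷ [] ∷ [])
                          (conflictFree-⊆ σ swap⊆ (proj₁ (proj₂ σ-ab)))
                          uncaused-ba

  no-preimage-of-ba : ¬ (Σ (List Ev) λ t → GESTrace γσ t × map ι t ≡ map ι (b ∷ a ∷ []))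
  no-preimage-of-ba (t , γσ-t , ι-t≡ι-ba) =
    not-trace-ba (subst (GESTrace γσ) (map-injective (separating-injective ιa≢ιb) ι-t≡ι-ba) γσ-t)
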